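{- Let $C\ge1$ and $n\ge1$ be integers and $h=\lceil n/2\rceil$. In the $C$-sequence model, $E_C[X]=E_C[Y]+E_C[Z]$, and $$C^n\,E_C[Y]=\sum_{i=1}^{h}\sum_{m=1}^{C}\ \sum_{\substack{T,S\ge0\\ T+S=\lfloor i/C\rfloor}}\left[\binom{i-1}{T}m^{T}(C-m)^{i-1-T}\right]\left[\binom{n-i}{S}(m-1)^{S}(C-m+1)^{n-i-S}\right],$$ with the convention $0^0=1$.
   Context: $C$-sequence model (for $C=2^k$ this describes a deck riffle-shuffled $k$ times). Cards $1,\dots,n$. An outcome is a word $w=(w_1,\dots,w_n)\in\{1,\dots,C\}^n$; all $C^n$ outcomes are equally likely and $E_C$ denotes expectation. For $m=1,\dots,C$ let $n_m=\#\{p:w_p=m\}$ and $N_m=n_1+\dots+n_m$ ($N_0=0$); the $m$-th increasing sequence consists of the values $N_{m-1}+1,\dots,N_m$, and the permutation $\pi$ determined by $w$ places these values, in increasing order, at the positions $p$ with $w_p=m$ taken from left to right. (Equivalently, the deck is cut into $C$ consecutive, possibly empty, piles which are then interleaved.) Let $h=\lceil n/2\rceil$. The strategy $\mathcal G^*$ guesses $\lfloor i/C\rfloor+1$ at position $i\le h$ and $n-\lfloor (n+1-j)/C\rfloor$ at position $j\ge h+1$ (i.e. $1$ repeated $C-1$ times, then each of $2,3,\dots$ repeated $C$ times from the top, and symmetrically from the bottom). $Y$ is the number of positions $i\le h$ with $\pi(i)=\lfloor i/C\rfloor+1$, $Z$ the number of positions $j\ge h+1$ with $\pi(j)=n-\lfloor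 (n+1-j)/C\rfloor$, and $X=Y+Z$. -}

module Defs where

open import Data.Nat using (ℕ; zero; suc; _+_; _*_; _∸_; _^_; NonZero; _≟_; _<?_)
open import Data.Nat.DivMod using (_/_)
open import Data.Nat.Combinatorics using () renaming (_C_ to binom)
import Relation.Nullary
import Data.Nat
open import Data.Nat.ListAction using (sum)
open import Data.List using (List; []; _∷_; map; concatMap; upTo; length; filter; take)

interval : ℕ → ℕ → List ℕ
interval a b = map (a +_) (upTo (suc b ∸ a))

sumFromTo : ℕ → ℕ → (ℕ → ℕ) → ℕ
sumFromTo a b f = sum (map f (interval a b))

words : ℕ → ℕ → List (List ℕ)
words C zero    = [] ∷ []
words C (suc n) = concatMap (λ m → map (m ∷_) (words C n)) (interval 1 C)

-- w_p for a 1-based position p (0 outside range)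
letterAt : List ℕ → ℕ → ℕ
letterAt []      _             = 0
letterAt (x ∷ w) zero          = 0
letterAt (x ∷ w) (suc zero)    = x
letterAt (x ∷ w) (suc (suc p)) = letterAt w (suc p)

perm : List ℕ → ℕ → ℕ
perm w p = length (filter (_<? m) w) + length (filter (_≟ m) (take p w))
  where m = letterAt w p

half : ℕ → ℕ
half n = suc n / 2

topGuess : (C : ℕ) → .{{NonZero C}} → ℕ → ℕ
topGuess C i = i / C + 1

botGuess : (C : ℕ) → .{{NonZero C}} → ℕ → ℕ → ℕ
botGuess C n j = n ∸ ((suc n ∸ j) / C)

Ycount : (C : ℕ) → .{{NonZero C}} → ℕ → List ℕ → ℕ
Ycount C n w = length (filter (λ i → perm w i ≟ topGuess C i) (interval 1 (half n)))

Zcount : (C : ℕ) → .{{NonZero C}} → ℕ → List ℕ → ℕ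
Zcount C n w = length (filter (λ j → perm w j ≟ botGuess C n j) (interval (suc (half n)) n))

guess : (C : ℕ) → .{{NonZero C}} → ℕ → ℕ → ℕ
guess C n p with p Data.Nat.≤? half n
... | Relation.Nullary.yes _ = topGuess C p
... | Relation.Nullary.no _  = botGuess C n p

Xcount : (C : ℕ) → .{{NonZero C}} → ℕ → List ℕ → ℕ
Xcount C n w = length (filter (λ p → perm w p ≟ guess C n p) (interval 1 n))

-- C^n E_C[F] = Σ_w F(w)
totalOver : ℕ → ℕ → (List ℕ → ℕ) → ℕ
totalOver C n F = sum (map F (words C n))

-- right-hand side of the formula (natural-number arithmetic; 0^0 = 1)
rhsY : (C : ℕ) → .{{NonZero C}} → ℕ → ℕ
rhsY C n =
  sumFromTo 1 (half n) λ i →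
  sumFromTo 1 C λ m →
  sumFromTo 0 (i / C) λ T →
    let S = i / C ∸ T in
    (binom (i ∸ 1) T * (m ^ T) * ((C ∸ m) ^ (i ∸ 1 ∸ T)))
    * (binom (n ∸ i) S * ((m ∸ 1) ^ S) * ((C ∸ m + 1) ^ (n ∸ i ∸ S)))

-- Splitting the total of X over its two ranges of positions gives E[X] = E[Y] + E[Z]; for E[Y]
-- one counts, for each position i, the words w with π(i) = ⌊i/C⌋ + 1. Write w = u ++ m ∷ v
-- with |u| = i - 1: then π(i) = 1 + #{letters of u that are ≤ m} + #{letters of v that are < m}.
-- Conditioned on m, the two counts are independent binomials over the uniform letters
-- (success probabilities m/C and (m-1)/C), so the number of words with π(i) = K + 1 is the
-- convolution of two binomial weights, which is the formula.
module Submission where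

open import Defs
open import Data.Nat using (ℕ; NonZero; _≤_; _+_)
open import Relation.Binary.PropositionalEquality using (_≡_)
open import Data.Product using (_×_)

open import Data.Bool using (Bool; true; false; not)
open import Data.List using (List; []; _∷_; _++_; map; concatMap; applyUpTo; upTo; length; filter; take)
open import Data.List.Properties using (map-++; map-∘; map-cong)
open import Data.Nat using (zero; suc; _*_; _∸_; _^_; _<_; _⊓_; z≤n; s≤s; _<ᵇ_; _≡ᵇ_; _≟_)
open import Data.Nat.Combinatorics using (nCk+nC[k+1]≡[n+1]C[k+1]; k>n⇒nCk≡0) renaming (_C_ to binom)
open import Data.Nat.DivMod using (_/_; m/n<m)
open import Data.Nat.ListAction using (sum)
open import Data.Nat.ListAction.Properties using (sum-++)
open import Data.Nat.Properties
open import Data.Nat.Solver using (module +-*-Solver)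
open import Data.Empty using (⊥-elim)
open import Data.Product using (_,_)
open import Function using (_∘_; id)
open import Relation.Binary.PropositionalEquality using (refl; sym; trans; cong; cong₂; subst; module ≡-Reasoning)
open import Relation.Nullary using (Dec; does; yes; no)
open import Relation.Unary using (Decidable)
open import Algebra.Properties.CommutativeSemigroup +-commutativeSemigroup using (interchange; x∙yz≈y∙xz)
open +-*-Solver using (solve; _:+_; _:*_; _:=_; con)
open ≡-Reasoning

private variable
  A B : Set

∑ : List A → (A → ℕ) → ℕ
∑ xs f = sum (map f xs)

infix 5 ∑
syntax ∑ xs (λ x → f) = ∑[ x ∈ xs ] f

∑-++ : ∀ (xs ys : List A) (f : A → ℕ) → ∑ (xs ++ ys) f ≡ ∑ xs f + ∑ ys f
∑-++ xs ys f = trans (cong sum (map-++ f xs ys)) (sum-++ (map f xs) (map f ys))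

∑-map : ∀ (g : A → B) xs (f : B → ℕ) → ∑ (map g xs) f ≡ ∑ xs (f ∘ g)
∑-map g xs f = cong sum (sym (map-∘ xs))

∑-concatMap : ∀ (g : A → List B) xs (f : B → ℕ) → ∑ (concatMap g xs) f ≡ ∑[ x ∈ xs ] ∑ (g x) f
∑-concatMap g []       f = refl
∑-concatMap g (x ∷ xs) f =
  trans (∑-++ (g x) (concatMap g xs) f) (cong (∑ (g x) f +_) (∑-concatMap g xs f))

∑-cong : ∀ (xs : List A) {f g : A → ℕ} → (∀ x → f x ≡ g x) → ∑ xs f ≡ ∑ xs g
∑-cong xs f≗g = cong sum (map-cong f≗g xs)

∑-zero : ∀ (xs : List A) {f : A → ℕ} → (∀ x → f x ≡ 0) → ∑ xs f ≡ 0
∑-zero []       f≗0 = refl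
∑-zero (x ∷ xs) f≗0 = cong₂ _+_ (f≗0 x) (∑-zero xs f≗0)

∑-+ : ∀ (xs : List A) (f g : A → ℕ) → ∑[ x ∈ xs ] (f x + g x) ≡ ∑ xs f + ∑ xs g
∑-+ []       f g = refl
∑-+ (x ∷ xs) f g = trans (cong (f x + g x +_) (∑-+ xs f g)) (interchange (f x) (g x) _ _)

∑-*ˡ : ∀ (xs : List A) k (f : A → ℕ) → ∑[ x ∈ xs ] (k * f x) ≡ k * ∑ xs f
∑-*ˡ []       k f = sym (*-zeroʳ k)
∑-*ˡ (x ∷ xs) k f = trans (cong (k * f x +_) (∑-*ˡ xs k f)) (sym (*-distribˡ-+ k (f x) _))

∑-*ʳ : ∀ (xs : List A) k (f : A → ℕ) → ∑[ x ∈ xs ] (f x * k) ≡ ∑ xs f * k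
∑-*ʳ []       k f = refl
∑-*ʳ (x ∷ xs) k f = trans (cong (f x * k +_) (∑-*ʳ xs k f)) (sym (*-distribʳ-+ k (f x) _))

∑-swap : ∀ (xs : List A) (ys : List B) (f : A → B → ℕ) →
  ∑[ x ∈ xs ] ∑[ y ∈ ys ] f x y ≡ ∑[ y ∈ ys ] ∑[ x ∈ xs ] f x y
∑-swap []       ys f = sym (∑-zero ys (λ _ → refl))
∑-swap (x ∷ xs) ys f =
  trans (cong (∑ ys (f x) +_) (∑-swap xs ys f)) (sym (∑-+ ys (f x) (λ y → ∑[ x′ ∈ xs ] f x′ y)))

∑< : ℕ → (ℕ → ℕ) → ℕ
∑< zero    F = 0
∑< (suc N) F = F 0 + ∑< N (F ∘ suc)

infix 5 ∑<
syntax ∑< N (λ j → F) = ∑[ j < N ] F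

∑<-cong : ∀ N {F G : ℕ → ℕ} → (∀ j → j < N → F j ≡ G j) → ∑< N F ≡ ∑< N G
∑<-cong zero    F≗G = refl
∑<-cong (suc N) F≗G = cong₂ _+_ (F≗G 0 (s≤s z≤n)) (∑<-cong N (λ j j<N → F≗G (suc j) (s≤s j<N)))

∑<-zero : ∀ N {F : ℕ → ℕ} → (∀ j → F j ≡ 0) → ∑< N F ≡ 0
∑<-zero zero    F≗0 = refl
∑<-zero (suc N) F≗0 = cong₂ _+_ (F≗0 0) (∑<-zero N (F≗0 ∘ suc))

∑<-+-split : ∀ h r (F : ℕ → ℕ) → ∑< (h + r) F ≡ ∑< h F + (∑[ j < r ] F (h + j))
∑<-+-split zero    r F = refl
∑<-+-split (suc h) r F = trans (cong (F 0 +_) (∑<-+-split h r (F ∘ suc))) (sym (+-assoc (F 0) _ _))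

∑-applyUpTo : ∀ N (g : ℕ → A) (f : A → ℕ) → ∑ (applyUpTo g N) f ≡ ∑[ j < N ] f (g j)
∑-applyUpTo zero    g f = refl
∑-applyUpTo (suc N) g f = cong (f (g 0) +_) (∑-applyUpTo N (g ∘ suc) f)

∑-upTo : ∀ N (f : ℕ → ℕ) → ∑ (upTo N) f ≡ ∑< N f
∑-upTo N f = ∑-applyUpTo N id f

∑-∑< : ∀ (xs : List A) N (F : A → ℕ → ℕ) → ∑[ x ∈ xs ] ∑[ j < N ] F x j ≡ ∑[ j < N ] ∑[ x ∈ xs ] F x j
∑-∑< xs N F = begin
  ∑[ x ∈ xs ] ∑[ j < N ] F x j      ≡⟨ ∑-cong xs (λ x → sym (∑-upTo N (F x))) ⟩
  ∑[ x ∈ xs ] ∑[ j ∈ upTo N ] F x j ≡⟨ ∑-swap xs (upTo N) F ⟩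
  ∑[ j ∈ upTo N ] ∑[ x ∈ xs ] F x j ≡⟨ ∑-upTo N _ ⟩
  ∑[ j < N ] ∑[ x ∈ xs ] F x j      ∎

sumFromTo-∑< : ∀ a b (f : ℕ → ℕ) → sumFromTo a b f ≡ ∑[ j < suc b ∸ a ] f (a + j)
sumFromTo-∑< a b f = trans (∑-map (a +_) (upTo (suc b ∸ a)) f) (∑-upTo (suc b ∸ a) _)

sumFromTo-cong : ∀ a b {f g : ℕ → ℕ} → (∀ i → a ≤ i → i ≤ b → f i ≡ g i) → sumFromTo a b f ≡ sumFromTo a b g
sumFromTo-cong a b {f} {g} f≗g = begin
  sumFromTo a b f               ≡⟨ sumFromTo-∑< a b f ⟩
  ∑[ j < suc b ∸ a ] f (a + j)  ≡⟨ ∑<-cong (suc b ∸ a) (λ j j< → f≗g (a + j) (m≤m+n a j) (a+j≤b j<)) ⟩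
  ∑[ j < suc b ∸ a ] g (a + j)  ≡⟨ sym (sumFromTo-∑< a b g) ⟩
  sumFromTo a b g               ∎
  where
  a+j≤b : ∀ {j} → j < suc b ∸ a → a + j ≤ b
  a+j≤b j< = ≤-pred (≤-trans (+-monoʳ-< a j<) (≤-reflexive (m+[n∸m]≡n {a} a≤1+b)))
    where
    a≤1+b : a ≤ suc b
    a≤1+b = <⇒≤ (m∸n≢0⇒n<m (m<n⇒n≢0 j<))

sumFromTo-split : ∀ {h n} (f : ℕ → ℕ) → h ≤ n → sumFromTo 1 n f ≡ sumFromTo 1 h f + sumFromTo (suc h) n f
sumFromTo-split {h} {n} f h≤n = begin
  sumFromTo 1 n f
    ≡⟨ sumFromTo-∑< 1 n f ⟩
  ∑[ j < n ] f (suc j)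
    ≡⟨ cong (λ N → ∑[ j < N ] f (suc j)) (sym (m+[n∸m]≡n h≤n)) ⟩
  ∑[ j < h + (n ∸ h) ] f (suc j)
    ≡⟨ ∑<-+-split h (n ∸ h) _ ⟩
  (∑[ j < h ] f (suc j)) + (∑[ j < n ∸ h ] f (suc (h + j)))
    ≡⟨ sym (cong₂ _+_ (sumFromTo-∑< 1 h f) (sumFromTo-∑< (suc h) n f)) ⟩
  sumFromTo 1 h f + sumFromTo (suc h) n f ∎

iverson : Bool → ℕ
iverson true  = 1
iverson false = 0

δ : ℕ → ℕ → ℕ
δ a b = iverson (a ≡ᵇ b)

count : (A → Bool) → List A → ℕ
count φ xs = ∑[ x ∈ xs ] iverson (φ x)

length-filter≡count : ∀ {P : A → Set} (P? : Decidable P) xs → length (filter P? xs) ≡ count (λ x → does (P? x)) xs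
length-filter≡count P? []       = refl
length-filter≡count P? (x ∷ xs) with does (P? x)
... | true  = cong suc (length-filter≡count P? xs)
... | false = length-filter≡count P? xs

∑-bool : ∀ (xs : List A) φ (G : Bool → ℕ) →
  ∑[ x ∈ xs ] G (φ x) ≡ count φ xs * G true + count (not ∘ φ) xs * G false
∑-bool []       φ G = refl
∑-bool (x ∷ xs) φ G = trans (cong (G (φ x) +_) (∑-bool xs φ G)) (step (φ x))
  where
  step : ∀ b → G b + (count φ xs * G true + count (not ∘ φ) xs * G false)
             ≡ (iverson b + count φ xs) * G true + (iverson (not b) + count (not ∘ φ) xs) * G false
  step true  = sym (+-assoc (G true) _ _)
  step false = x∙yz≈y∙xz (G false) (count φ xs * G true) (count (not ∘ φ) xs * G false)

δ-+ : ∀ a b K → δ (a + b) K ≡ ∑[ T < suc K ] δ a T * δ b (K ∸ T)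
δ-+ zero    b K       = sym (trans (cong₂ _+_ (*-identityˡ (δ b K)) (∑<-zero K (λ _ → refl))) (+-identityʳ (δ b K)))
δ-+ (suc a) b zero    = refl
δ-+ (suc a) b (suc K) = δ-+ a b K

∑-∑-δ-+ : {A B : Set} (xs : List A) (ys : List B) (c : A → ℕ) (d : B → ℕ) (K : ℕ) →
  ∑[ x ∈ xs ] ∑[ y ∈ ys ] δ (c x + d y) K ≡ ∑[ T < suc K ] ((∑[ x ∈ xs ] δ (c x) T) * (∑[ y ∈ ys ] δ (d y) (K ∸ T)))
∑-∑-δ-+ {A} {B} xs ys c d K = begin
  ∑[ x ∈ xs ] ∑[ y ∈ ys ] δ (c x + d y) K
    ≡⟨ ∑-cong xs (λ x → ∑-cong ys (λ y → δ-+ (c x) (d y) K)) ⟩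
  ∑[ x ∈ xs ] ∑[ y ∈ ys ] ∑[ T < suc K ] term x y T
    ≡⟨ ∑-cong xs (λ x → ∑-∑< ys (suc K) (term x)) ⟩
  ∑[ x ∈ xs ] ∑[ T < suc K ] ∑[ y ∈ ys ] term x y T
    ≡⟨ ∑-∑< xs (suc K) (λ x T → ∑[ y ∈ ys ] term x y T) ⟩
  ∑[ T < suc K ] ∑[ x ∈ xs ] ∑[ y ∈ ys ] term x y T
    ≡⟨ ∑<-cong (suc K) (λ T _ → trans (∑-cong xs (λ x → ∑-*ˡ ys (δ (c x) T) (λ y → δ (d y) (K ∸ T))))
                                       (∑-*ʳ xs _ (λ x → δ (c x) T))) ⟩
  ∑[ T < suc K ] ((∑[ x ∈ xs ] δ (c x) T) * (∑[ y ∈ ys ] δ (d y) (K ∸ T))) ∎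
  where
  term : A → B → ℕ → ℕ
  term x y T = δ (c x) T * δ (d y) (K ∸ T)

binomialTerm : ℕ → ℕ → ℕ → ℕ → ℕ
binomialTerm a T p q = binom a T * p ^ T * q ^ (a ∸ T)

binomialTerm-pascal₀ : ∀ a p q → q * binomialTerm a 0 p q ≡ binomialTerm (suc a) 0 p q
binomialTerm-pascal₀ a p q = solve 2 (λ q e → q :* (con 1 :* con 1 :* e) := con 1 :* con 1 :* (q :* e)) refl q (q ^ a)

binomialTerm-pascal : ∀ a t p q →
  p * binomialTerm a t p q + q * binomialTerm a (suc t) p q ≡ binomialTerm (suc a) (suc t) p q
binomialTerm-pascal a t p q = begin
  p * binomialTerm a t p q + q * binomialTerm a (suc t) p q
    ≡⟨ collect (a ≤? t) ⟩
  (binom a t + binom a (suc t)) * p ^ suc t * q ^ (a ∸ t)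
    ≡⟨ cong (λ c → c * p ^ suc t * q ^ (a ∸ t)) (nCk+nC[k+1]≡[n+1]C[k+1] a t) ⟩
  binomialTerm (suc a) (suc t) p q ∎
  where
  c c′ : ℕ
  c  = binom a t
  c′ = binom a (suc t)

  -- Split on a ≤ t because a ∸ t = 1 + (a ∸ suc t) only holds when t < a; otherwise binom a (suc t) = 0.
  collect : Dec (a ≤ t) → p * binomialTerm a t p q + q * binomialTerm a (suc t) p q
                        ≡ (c + c′) * p ^ suc t * q ^ (a ∸ t)
  collect (yes a≤t) = begin
    p * (c * p ^ t * q ^ (a ∸ t)) + q * (c′ * p ^ suc t * q ^ (a ∸ suc t))
      ≡⟨ cong (λ x → p * (c * p ^ t * q ^ (a ∸ t)) + q * (x * p ^ suc t * q ^ (a ∸ suc t))) c′≡0 ⟩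
    p * (c * p ^ t * q ^ (a ∸ t)) + q * 0
      ≡⟨ solve 5 (λ p q c pt e → p :* (c :* pt :* e) :+ q :* con 0 := (c :+ con 0) :* (p :* pt) :* e) refl p q c (p ^ t) (q ^ (a ∸ t)) ⟩
    (c + 0) * p ^ suc t * q ^ (a ∸ t)
      ≡⟨ cong (λ x → (c + x) * p ^ suc t * q ^ (a ∸ t)) (sym c′≡0) ⟩
    (c + c′) * p ^ suc t * q ^ (a ∸ t) ∎
    where
    c′≡0 : c′ ≡ 0
    c′≡0 = k>n⇒nCk≡0 {a} {suc t} (s≤s a≤t)
  collect (no a≰t) = begin
    p * (c * p ^ t * q ^ (a ∸ t)) + q * (c′ * p ^ suc t * q ^ (a ∸ suc t))
      ≡⟨ cong (λ x → p * (c * p ^ t * x) + q * (c′ * p ^ suc t * q ^ (a ∸ suc t))) q^[a∸t] ⟩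
    p * (c * p ^ t * (q * q ^ (a ∸ suc t))) + q * (c′ * p ^ suc t * q ^ (a ∸ suc t))
      ≡⟨ solve 6 (λ p q c c′ pt e → p :* (c :* pt :* (q :* e)) :+ q :* (c′ :* (p :* pt) :* e) := (c :+ c′) :* (p :* pt) :* (q :* e))
           refl p q c c′ (p ^ t) (q ^ (a ∸ suc t)) ⟩
    (c + c′) * p ^ suc t * (q * q ^ (a ∸ suc t))
      ≡⟨ cong (λ x → (c + c′) * p ^ suc t * x) (sym q^[a∸t]) ⟩
    (c + c′) * p ^ suc t * q ^ (a ∸ t) ∎
    where
    q^[a∸t] : q ^ (a ∸ t) ≡ q * q ^ (a ∸ suc t)
    q^[a∸t] = cong (q ^_) (+-∸-assoc 1 {a} {suc t} (≰⇒> a≰t))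

count-<ᵇ-interval : ∀ C k → count (_<ᵇ suc k) (interval 1 C) ≡ k ⊓ C
count-<ᵇ-interval C k = trans (sumFromTo-∑< 1 C _) (∑<-<ᵇ C k)
  where
  ∑<-<ᵇ : ∀ N k → ∑[ j < N ] iverson (j <ᵇ k) ≡ k ⊓ N
  ∑<-<ᵇ zero    zero    = refl
  ∑<-<ᵇ zero    (suc k) = refl
  ∑<-<ᵇ (suc N) zero    = ∑<-zero N (λ _ → refl)
  ∑<-<ᵇ (suc N) (suc k) = cong suc (∑<-<ᵇ N k)

count-≮ᵇ-interval : ∀ C k → count (not ∘ (_<ᵇ suc k)) (interval 1 C) ≡ C ∸ k
count-≮ᵇ-interval C k = trans (sumFromTo-∑< 1 C _) (∑<-≮ᵇ C k)
  where
  ∑<-≮ᵇ : ∀ N k → ∑[ j < N ] iverson (not (j <ᵇ k)) ≡ N ∸ k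
  ∑<-≮ᵇ zero    k       = sym (0∸n≡0 k)
  ∑<-≮ᵇ (suc N) zero    = cong suc (∑<-≮ᵇ N zero)
  ∑<-≮ᵇ (suc N) (suc k) = ∑<-≮ᵇ N k

letterAt-++-∷ : ∀ u m v → letterAt (u ++ m ∷ v) (suc (length u)) ≡ m
letterAt-++-∷ []      m v = refl
letterAt-++-∷ (x ∷ u) m v = letterAt-++-∷ u m v

take-++-∷ : ∀ u (m : ℕ) v → take (suc (length u)) (u ++ m ∷ v) ≡ u ++ m ∷ []
take-++-∷ []      m v = refl
take-++-∷ (x ∷ u) m v = cong (x ∷_) (take-++-∷ u m v)

count-++ : ∀ φ (xs ys : List A) → count φ (xs ++ ys) ≡ count φ xs + count φ ys
count-++ φ xs ys = ∑-++ xs ys (iverson ∘ φ)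

<ᵇ-irrefl : ∀ m → (m <ᵇ m) ≡ false
<ᵇ-irrefl zero    = refl
<ᵇ-irrefl (suc m) = <ᵇ-irrefl m

≡ᵇ-refl : ∀ m → (m ≡ᵇ m) ≡ true
≡ᵇ-refl zero    = refl
≡ᵇ-refl (suc m) = ≡ᵇ-refl m

count-<ᵇ+count-≡ᵇ : ∀ m (xs : List ℕ) → count (_<ᵇ m) xs + count (_≡ᵇ m) xs ≡ count (_<ᵇ suc m) xs
count-<ᵇ+count-≡ᵇ m xs = trans (sym (∑-+ xs _ _)) (∑-cong xs (λ x → pointwise x m))
  where
  pointwise : ∀ x m → iverson (x <ᵇ m) + iverson (x ≡ᵇ m) ≡ iverson (x <ᵇ suc m)
  pointwise zero    zero    = refl
  pointwise zero    (suc m) = refl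
  pointwise (suc x) zero    = refl
  pointwise (suc x) (suc m) = pointwise x m

perm-++-∷ : ∀ u m v → perm (u ++ m ∷ v) (suc (length u)) ≡ suc (count (_<ᵇ suc m) u + count (_<ᵇ m) v)
perm-++-∷ u m v = begin
  perm w p
    ≡⟨ cong (λ z → length (filter (_<? z) w) + length (filter (_≟ z) (take p w))) (letterAt-++-∷ u m v) ⟩
  length (filter (_<? m) w) + length (filter (_≟ m) (take p w))
    ≡⟨ cong₂ _+_ (length-filter≡count (_<? m) w)
                 (trans (cong (length ∘ filter (_≟ m)) (take-++-∷ u m v)) (length-filter≡count (_≟ m) (u ++ m ∷ []))) ⟩
  count (_<ᵇ m) (u ++ m ∷ v) + count (_≡ᵇ m) (u ++ m ∷ [])
    ≡⟨ cong₂ _+_ (count-++ (_<ᵇ m) u (m ∷ v)) (count-++ (_≡ᵇ m) u (m ∷ [])) ⟩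
  c< u + (iverson (m <ᵇ m) + c< v) + (c≡ u + (iverson (m ≡ᵇ m) + 0))
    ≡⟨ cong₂ (λ x y → c< u + (iverson x + c< v) + (c≡ u + (iverson y + 0))) (<ᵇ-irrefl m) (≡ᵇ-refl m) ⟩
  c< u + c< v + (c≡ u + 1)
    ≡⟨ solve 3 (λ a b c → a :+ b :+ (c :+ con 1) := con 1 :+ (a :+ c :+ b)) refl (c< u) (c< v) (c≡ u) ⟩
  suc (c< u + c≡ u + c< v)
    ≡⟨ cong (λ z → suc (z + c< v)) (count-<ᵇ+count-≡ᵇ m u) ⟩
  suc (count (_<ᵇ suc m) u + c< v) ∎
  where
  w : List ℕ
  w = u ++ m ∷ v
  p : ℕ
  p = suc (length u)
  c< c≡ : List ℕ → ℕ
  c< = count (_<ᵇ m)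
  c≡ = count (_≡ᵇ m)

module _ (C : ℕ) where

  letters : List ℕ
  letters = interval 1 C

  ∑-words-suc : ∀ a (g : List ℕ → ℕ) → ∑ (words C (suc a)) g ≡ ∑[ x ∈ letters ] ∑[ u ∈ words C a ] g (x ∷ u)
  ∑-words-suc a g =
    trans (∑-concatMap (λ m → map (m ∷_) (words C a)) letters g) (∑-cong letters (λ x → ∑-map (x ∷_) (words C a) g))

  ∑-words-length : ∀ a (g : List ℕ → ℕ → ℕ) → ∑[ u ∈ words C a ] g u (length u) ≡ ∑[ u ∈ words C a ] g u a
  ∑-words-length zero    g = refl
  ∑-words-length (suc a) g = begin
    ∑[ u ∈ words C (suc a) ] g u (length u)                 ≡⟨ ∑-words-suc a _ ⟩
    ∑[ x ∈ letters ] ∑[ u ∈ words C a ] g (x ∷ u) (suc (length u)) ≡⟨ ∑-cong letters (λ x → ∑-words-length a (λ u l → g (x ∷ u) (suc l))) ⟩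
    ∑[ x ∈ letters ] ∑[ u ∈ words C a ] g (x ∷ u) (suc a)  ≡⟨ sym (∑-words-suc a _) ⟩
    ∑[ u ∈ words C (suc a) ] g u (suc a)                     ∎

  ∑-words-++ : ∀ a b (f : List ℕ → ℕ) →
    ∑ (words C (a + suc b)) f ≡ ∑[ u ∈ words C a ] ∑[ m ∈ letters ] ∑[ v ∈ words C b ] f (u ++ m ∷ v)
  ∑-words-++ zero    b f = trans (∑-words-suc b f) (sym (+-identityʳ _))
  ∑-words-++ (suc a) b f =
    trans (∑-words-suc (a + suc b) f) (trans (∑-cong letters (λ x → ∑-words-++ a b (f ∘ (x ∷_)))) (sym (∑-words-suc a _)))

  ∑-words-δ-count : ∀ φ a T → ∑[ u ∈ words C a ] δ (count φ u) T ≡ binomialTerm a T (count φ letters) (count (not ∘ φ) letters)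
  ∑-words-δ-count φ zero    zero    = refl
  ∑-words-δ-count φ zero    (suc t) = refl
  ∑-words-δ-count φ (suc a) T       = begin
    ∑[ u ∈ words C (suc a) ] δ (count φ u) T ≡⟨ ∑-words-suc a _ ⟩
    ∑[ x ∈ letters ] G (φ x)                 ≡⟨ ∑-bool letters φ G ⟩
    p * G true + q * G false                 ≡⟨ pascal T ⟩
    binomialTerm (suc a) T p q               ∎
    where
    p q : ℕ
    p = count φ letters
    q = count (not ∘ φ) letters
    G : Bool → ℕ
    G b = ∑[ u ∈ words C a ] δ (iverson b + count φ u) T
    pascal : ∀ T → p * (∑[ u ∈ words C a ] δ (suc (count φ u)) T) + q * (∑[ u ∈ words C a ] δ (count φ u) T)
                 ≡ binomialTerm (suc a) T p q
    pascal zero    = begin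
      p * (∑[ u ∈ words C a ] 0) + q * (∑[ u ∈ words C a ] δ (count φ u) 0)
        ≡⟨ cong₂ (λ x y → p * x + q * y) (∑-zero (words C a) (λ _ → refl)) (∑-words-δ-count φ a 0) ⟩
      p * 0 + q * binomialTerm a 0 p q
        ≡⟨ cong (_+ q * binomialTerm a 0 p q) (*-zeroʳ p) ⟩
      q * binomialTerm a 0 p q
        ≡⟨ binomialTerm-pascal₀ a p q ⟩
      binomialTerm (suc a) 0 p q ∎
    pascal (suc t) = trans (cong₂ (λ x y → p * x + q * y) (∑-words-δ-count φ a t) (∑-words-δ-count φ a (suc t)))
                           (binomialTerm-pascal a t p q)

  ∑-words-δ-count-≤ : ∀ a m → m ≤ C → ∀ T →
    ∑[ u ∈ words C a ] δ (count (_<ᵇ suc m) u) T ≡ binomialTerm a T m (C ∸ m)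
  ∑-words-δ-count-≤ a m m≤C T = begin
    ∑[ u ∈ words C a ] δ (count (_<ᵇ suc m) u) T ≡⟨ ∑-words-δ-count (_<ᵇ suc m) a T ⟩
    binomialTerm a T (count (_<ᵇ suc m) letters) (count (not ∘ (_<ᵇ suc m)) letters)
      ≡⟨ cong₂ (binomialTerm a T) (trans (count-<ᵇ-interval C m) (m≤n⇒m⊓n≡m m≤C)) (count-≮ᵇ-interval C m) ⟩
    binomialTerm a T m (C ∸ m) ∎

  ∑-words-δ-count-< : ∀ b m → 1 ≤ m → m ≤ C → ∀ S →
    ∑[ v ∈ words C b ] δ (count (_<ᵇ m) v) S ≡ binomialTerm b S (m ∸ 1) (C ∸ m + 1)
  ∑-words-δ-count-< b (suc j) _ j<C S = begin
    ∑[ v ∈ words C b ] δ (count (_<ᵇ suc j) v) S ≡⟨ ∑-words-δ-count (_<ᵇ suc j) b S ⟩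
    binomialTerm b S (count (_<ᵇ suc j) letters) (count (not ∘ (_<ᵇ suc j)) letters)
      ≡⟨ cong₂ (binomialTerm b S) (trans (count-<ᵇ-interval C j) (m≤n⇒m⊓n≡m (<⇒≤ j<C)))
                                  (trans (count-≮ᵇ-interval C j) C∸j≡C∸[1+j]+1) ⟩
    binomialTerm b S j (C ∸ suc j + 1) ∎
    where
    C∸j≡C∸[1+j]+1 : C ∸ j ≡ C ∸ suc j + 1
    C∸j≡C∸[1+j]+1 = trans (+-∸-assoc 1 j<C) (+-comm 1 _)

  positionValueCount : ℕ → ℕ → ℕ → ℕ
  positionValueCount a b K =
    sumFromTo 1 C λ m → sumFromTo 0 K λ T → binomialTerm a T m (C ∸ m) * binomialTerm b (K ∸ T) (m ∸ 1) (C ∸ m + 1)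

  ∑-words-δ-perm : ∀ a b K → ∑[ w ∈ words C (a + suc b) ] δ (perm w (suc a)) (suc K) ≡ positionValueCount a b K
  ∑-words-δ-perm a b K = begin
    ∑[ w ∈ words C (a + suc b) ] δ (perm w (suc a)) (suc K)
      ≡⟨ ∑-words-++ a b _ ⟩
    ∑[ u ∈ words C a ] ∑[ m ∈ letters ] ∑[ v ∈ words C b ] δ (perm (u ++ m ∷ v) (suc a)) (suc K)
      ≡⟨ sym (∑-words-length a (λ u l → ∑[ m ∈ letters ] ∑[ v ∈ words C b ] δ (perm (u ++ m ∷ v) (suc l)) (suc K))) ⟩
    ∑[ u ∈ words C a ] ∑[ m ∈ letters ] ∑[ v ∈ words C b ] δ (perm (u ++ m ∷ v) (suc (length u))) (suc K)
      ≡⟨ ∑-cong (words C a) (λ u → ∑-cong letters (λ m → ∑-cong (words C b) (λ v →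
           cong (λ z → δ z (suc K)) (perm-++-∷ u m v)))) ⟩
    ∑[ u ∈ words C a ] ∑[ m ∈ letters ] ∑[ v ∈ words C b ] δ (count≤ m u + count< m v) K
      ≡⟨ ∑-swap (words C a) letters _ ⟩
    ∑[ m ∈ letters ] ∑[ u ∈ words C a ] ∑[ v ∈ words C b ] δ (count≤ m u + count< m v) K
      ≡⟨ ∑-cong letters (λ m → ∑-∑-δ-+ (words C a) (words C b) (count≤ m) (count< m) K) ⟩
    ∑[ m ∈ letters ] ∑[ T < suc K ] ((∑[ u ∈ words C a ] δ (count≤ m u) T) * (∑[ v ∈ words C b ] δ (count< m v) (K ∸ T)))
      ≡⟨ sumFromTo-cong 1 C (λ m 1≤m m≤C → trans (∑<-cong (suc K) (λ T _ →
           cong₂ _*_ (∑-words-δ-count-≤ a m m≤C T) (∑-words-δ-count-< b m 1≤m m≤C (K ∸ T))))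
           (sym (sumFromTo-∑< 0 K _))) ⟩
    positionValueCount a b K ∎
    where
    count≤ count< : ℕ → List ℕ → ℕ
    count≤ m = count (_<ᵇ suc m)
    count< m = count (_<ᵇ m)

half≤n : ∀ {n} → 1 ≤ n → half n ≤ n
half≤n {suc n} _ = ≤-pred (m/n<m (suc (suc n)) 2 (s≤s (s≤s z≤n)))

module _ (C : ℕ) .{{_ : NonZero C}} (n : ℕ) where

  guess-top : ∀ {p} → p ≤ half n → guess C n p ≡ topGuess C p
  guess-top {p} p≤h with p ≤? half n
  ... | yes _   = refl
  ... | no  p≰h = ⊥-elim (p≰h p≤h)

  guess-bot : ∀ {p} → half n < p → guess C n p ≡ botGuess C n p
  guess-bot {p} h<p with p ≤? half n
  ... | yes p≤h = ⊥-elim (<⇒≱ h<p p≤h)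
  ... | no  _   = refl

  Xcount≡Ycount+Zcount : 1 ≤ n → ∀ w → Xcount C n w ≡ Ycount C n w + Zcount C n w
  Xcount≡Ycount+Zcount 1≤n w = begin
    Xcount C n w
      ≡⟨ length-filter≡count (λ p → perm w p ≟ guess C n p) (interval 1 n) ⟩
    sumFromTo 1 n (hit (guess C n))
      ≡⟨ sumFromTo-split (hit (guess C n)) (half≤n 1≤n) ⟩
    sumFromTo 1 h (hit (guess C n)) + sumFromTo (suc h) n (hit (guess C n))
      ≡⟨ cong₂ _+_ (sumFromTo-cong 1 h (λ p _ p≤h → cong (δ (perm w p)) (guess-top p≤h)))
                   (sumFromTo-cong (suc h) n (λ p h<p _ → cong (δ (perm w p)) (guess-bot h<p))) ⟩
    sumFromTo 1 h (hit (topGuess C)) + sumFromTo (suc h) n (hit (botGuess C n))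
      ≡⟨ sym (cong₂ _+_ (length-filter≡count (λ i → perm w i ≟ topGuess C i) (interval 1 h))
                        (length-filter≡count (λ j → perm w j ≟ botGuess C n j) (interval (suc h) n))) ⟩
    Ycount C n w + Zcount C n w ∎
    where
    h : ℕ
    h = half n
    hit : (ℕ → ℕ) → ℕ → ℕ
    hit g p = δ (perm w p) (g p)

  ∑-words-δ-perm-topGuess : ∀ i → 1 ≤ i → i ≤ n →
    ∑[ w ∈ words C n ] δ (perm w i) (topGuess C i) ≡ positionValueCount C (i ∸ 1) (n ∸ i) (i / C)
  ∑-words-δ-perm-topGuess (suc a) _ a<n = begin
    ∑[ w ∈ words C n ] δ (perm w (suc a)) (K + 1) ≡⟨ cong (λ k → ∑[ w ∈ words C n ] δ (perm w (suc a)) k) (+-comm K 1) ⟩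
    ∑[ w ∈ words C n ] δ (perm w (suc a)) (suc K) ≡⟨ subst (λ N → ∑[ w ∈ words C N ] δ (perm w (suc a)) (suc K) ≡ positionValueCount C a b K)
                                                           a+[1+b]≡n (∑-words-δ-perm C a b K) ⟩
    positionValueCount C a b K                     ∎
    where
    K b : ℕ
    K = suc a / C
    b = n ∸ suc a
    a+[1+b]≡n : a + suc b ≡ n
    a+[1+b]≡n = trans (+-suc a b) (m+[n∸m]≡n a<n)

  totalOver-Ycount : 1 ≤ n → totalOver C n (Ycount C n) ≡ rhsY C n
  totalOver-Ycount 1≤n = begin
    totalOver C n (Ycount C n)
      ≡⟨ ∑-cong (words C n) (λ w → length-filter≡count (λ i → perm w i ≟ topGuess C i) (interval 1 (half n))) ⟩
    ∑[ w ∈ words C n ] sumFromTo 1 (half n) (λ i → δ (perm w i) (topGuess C i))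
      ≡⟨ ∑-swap (words C n) (interval 1 (half n)) _ ⟩
    sumFromTo 1 (half n) (λ i → ∑[ w ∈ words C n ] δ (perm w i) (topGuess C i))
      ≡⟨ sumFromTo-cong 1 (half n) (λ i 1≤i i≤h → ∑-words-δ-perm-topGuess i 1≤i (≤-trans i≤h (half≤n 1≤n))) ⟩
    rhsY C n ∎

theorem3 : (C n : ℕ) → .{{_ : NonZero C}} → 1 ≤ n →
    (totalOver C n (Xcount C n) ≡ totalOver C n (Ycount C n) + totalOver C n (Zcount C n))
    × (totalOver C n (Ycount C n) ≡ rhsY C n)
theorem3 C n 1≤n =
  trans (∑-cong (words C n) (Xcount≡Ycount+Zcount C n 1≤n)) (∑-+ (words C n) (Ycount C n) (Zcount C n)) ,
  totalOver-Ycount C n 1≤n
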